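{- Every connected $4$-regular graph of odd order has a rooted $2$-odd decomposition, i.e.\ a decomposition into two closed trails, each of odd length, that have a vertex in common.
   Context: Graphs are finite and may have multiple edges and loops (a loop contributes $2$ to the degree of its vertex). A graph is eulerian if it is connected and every vertex has even degree. A decomposition of a graph $G$ is a set $\{G_1,\dots,G_k\}$ of subgraphs of $G$ whose edge sets partition $E(G)$. A decomposition is $k$-odd if it has $k$ constituents, each of which is an eulerian subgraph (equivalently, a closed trail) with an odd number of edges. It is rooted if there is a vertex $v$ of $G$ (a root) contained in every constituent. -}

module Defs where

open import Data.Nat using (ℕ; zero; suc; _+_; _%_)
open import Data.Fin using (Fin; zero; suc)
open import Data.Bool using (Bool; true; false; if_then_else_; not)
open import Data.Product using (_×_; _,_; proj₁; proj₂; ∃; ∃-syntax)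
open import Data.Sum using (_⊎_)
open import Relation.Binary.PropositionalEquality using (_≡_)
open import Relation.Nullary using (does)
open import Data.Fin using (_≟_)

-- A finite multigraph (loops and parallel edges allowed):
-- vertices Fin n, edges Fin m, each edge has two endpoints.
record Graph : Set where
  field
    n    : ℕ
    m    : ℕ
    ends : Fin m → Fin n × Fin n
open Graph public

sumFin : (k : ℕ) → (Fin k → ℕ) → ℕ
sumFin zero    f = 0
sumFin (suc k) f = f zero + sumFin k (λ i → f (suc i))

EdgeSet : Graph → Set
EdgeSet G = Fin (m G) → Bool

-- number of ends of edge e at vertex v (a loop contributes 2)
endsAt : (G : Graph) → Fin (m G) → Fin (n G) → ℕ
endsAt G e v =
  (if does (proj₁ (ends G e) ≟ v) then 1 else 0) +
  (if does (proj₂ (ends G e) ≟ v) then 1 else 0)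

degIn : (G : Graph) → EdgeSet G → Fin (n G) → ℕ
degIn G S v = sumFin (m G) (λ e → if S e then endsAt G e v else 0)

size : (G : Graph) → EdgeSet G → ℕ
size G S = sumFin (m G) (λ e → if S e then 1 else 0)

allEdges : (G : Graph) → EdgeSet G
allEdges G e = true

deg : (G : Graph) → Fin (n G) → ℕ
deg G = degIn G (allEdges G)

Incident : (G : Graph) → EdgeSet G → Fin (n G) → Set
Incident G S v = ∃[ e ] (S e ≡ true × (proj₁ (ends G e) ≡ v ⊎ proj₂ (ends G e) ≡ v))

data Reach (G : Graph) (S : EdgeSet G) (u : Fin (n G)) : Fin (n G) → Set where
  here  : Reach G S u u
  fwd   : (e : Fin (m G)) → S e ≡ true →
          Reach G S u (proj₁ (ends G e)) → Reach G S u (proj₂ (ends G e))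
  bwd   : (e : Fin (m G)) → S e ≡ true →
          Reach G S u (proj₂ (ends G e)) → Reach G S u (proj₁ (ends G e))

Connected : Graph → Set
Connected G = (u v : Fin (n G)) → Reach G (allEdges G) u v

Regular : ℕ → Graph → Set
Regular d G = (v : Fin (n G)) → deg G v ≡ d

-- the subgraph of G with edge set S and vertex set the vertices incident
-- with S is eulerian: connected, and every vertex has even degree
Eulerian : (G : Graph) → EdgeSet G → Set
Eulerian G S =
  ((u v : Fin (n G)) → Incident G S u → Incident G S v → Reach G S u v) ×
  ((v : Fin (n G)) → degIn G S v % 2 ≡ 0)

OddEulerian : (G : Graph) → EdgeSet G → Set
OddEulerian G S = Eulerian G S × size G S % 2 ≡ 1

-- a rooted 2-odd decomposition: a partition of E(G) into the edges coloured
-- true and those coloured false, both odd eulerian, sharing a vertex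
Rooted2OddDecomposition : Graph → Set
Rooted2OddDecomposition G =
  ∃[ c ] (OddEulerian G c × OddEulerian G (λ e → not (c e)) ×
          ∃[ r ] (Incident G c r × Incident G (λ e → not (c e)) r))

-- Take an Euler tour T of G. As G is 4-regular, T leaves every vertex exactly twice, so it has
-- length 2n and makes n departures at even steps. Since n is odd, not every vertex can be left
-- 0 or 2 times at even steps: some v is left once at an even step and once at an odd step. The
-- part of T between these two departures is a closed trail through v of odd length, and the
-- rest of T is a closed trail through v of length 2n minus an odd number, hence odd.
module Submission where

open import Defs
open import Data.Nat using (ℕ; zero; suc; _+_; _*_; _%_; _≤_; _<_; z≤n; s≤s; _≤?_; _≡ᵇ_; ⌈_/2⌉; ⌊_/2⌋)
open import Data.Nat.Properties
  using (+-comm; +-assoc; +-suc; +-identityʳ; *-identityˡ; *-identityʳ; *-distribʳ-+;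
         +-cancelˡ-≡; +-cancelʳ-≡; +-mono-≤; ≤-refl; ≤-reflexive; ≤-trans; m≤n+m; <⇒≱; suc-injective; n≢0⇒n>0;
         n≤0⇒n≡0; ≤-pred; ≰⇒>; +-commutativeSemigroup)
  renaming (_≟_ to _≟ℕ_)
open import Data.Fin using (Fin; zero; suc)
open import Data.Fin.Properties using (_≟_; any?)
open import Data.Bool using (Bool; true; false; if_then_else_; not; _xor_)
open import Data.Bool.Properties using (not-involutive; not-distribˡ-xor; xor-same; xor-inverseʳ)
open import Data.Product using (_×_; _,_; proj₁; proj₂; Σ)
open import Data.Sum using (_⊎_; inj₁; inj₂)
open import Data.Empty using (⊥; ⊥-elim)
open import Relation.Binary.PropositionalEquality
open import Relation.Nullary using (does; yes; no)
open import Relation.Nullary.Decidable using (_×-dec_)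
open import Algebra.Properties.CommutativeSemigroup +-commutativeSemigroup using (interchange)

indicator : Bool → ℕ
indicator b = if b then 1 else 0

indicator-injective : ∀ {a b} → indicator a ≡ indicator b → a ≡ b
indicator-injective {true}  {true}  _ = refl
indicator-injective {false} {false} _ = refl

if-then-0≡indicator* : ∀ b a → (if b then a else 0) ≡ indicator b * a
if-then-0≡indicator* true  a = sym (*-identityˡ a)
if-then-0≡indicator* false a = refl

+≡1⇒indicators : ∀ a b → a + b ≡ 1 → a ≡ indicator (a ≡ᵇ 1) × b ≡ indicator (not (a ≡ᵇ 1))
+≡1⇒indicators zero          b eq = refl , eq
+≡1⇒indicators (suc zero)    zero _ = refl , refl

m+m≡n+n⇒m≡n : ∀ m n → m + m ≡ n + n → m ≡ n
m+m≡n+n⇒m≡n zero    zero    _  = refl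
m+m≡n+n⇒m≡n (suc m) (suc n) eq rewrite +-suc m m | +-suc n n =
  cong suc (m+m≡n+n⇒m≡n m n (suc-injective (suc-injective eq)))

⌈n+n/2⌉≡n : ∀ n → ⌈ n + n /2⌉ ≡ n
⌈n+n/2⌉≡n zero    = refl
⌈n+n/2⌉≡n (suc n) rewrite +-suc n n = cong suc (⌈n+n/2⌉≡n n)

odd : ℕ → Bool
odd zero    = false
odd (suc k) = not (odd k)

odd-+ : ∀ a b → odd (a + b) ≡ odd a xor odd b
odd-+ zero    b = refl
odd-+ (suc a) b = trans (cong not (odd-+ a b)) (not-distribˡ-xor (odd a) (odd b))

odd-double : ∀ k → odd (k + k) ≡ false
odd-double k = trans (odd-+ k k) (xor-same (odd k))

odd-summand : ∀ a b → odd (a + b) ≡ false → odd a ≡ true → odd b ≡ true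
odd-summand a b even-sum odd-a = xor-false (trans (sym (odd-+ a b)) even-sum) odd-a
  where
    xor-false : ∀ {x y} → x xor y ≡ false → x ≡ true → y ≡ true
    xor-false {true}  {true}  _  _  = refl
    xor-false {true}  {false} () _
    xor-false {false} {_}     _  ()

odd-%2 : ∀ k → k % 2 ≡ indicator (odd k)
odd-%2 zero          = refl
odd-%2 (suc zero)    = refl
odd-%2 (suc (suc k)) = trans (odd-%2 k) (cong indicator (sym (not-involutive (odd k))))

%2⇒odd : ∀ k b → k % 2 ≡ indicator b → odd k ≡ b
%2⇒odd k b eq = indicator-injective (trans (sym (odd-%2 k)) eq)

odd⇒%2 : ∀ k {b} → odd k ≡ b → k % 2 ≡ indicator b
odd⇒%2 k refl = odd-%2 k

≢1∧+≡2⇒even : ∀ a b → a + b ≡ 2 → a ≢ 1 → odd a ≡ false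
≢1∧+≡2⇒even zero                b _ _   = refl
≢1∧+≡2⇒even (suc zero)          b _ a≢1 = ⊥-elim (a≢1 refl)
≢1∧+≡2⇒even (suc (suc zero))    b _ _   = refl
≢1∧+≡2⇒even (suc (suc (suc a))) b ()

δ : ∀ {k} → Fin k → Fin k → ℕ
δ a b = indicator (does (a ≟ b))

δ-refl : ∀ {k} (a : Fin k) → δ a a ≡ 1
δ-refl a with a ≟ a
... | yes _   = refl
... | no a≢a = ⊥-elim (a≢a refl)

δ-≢ : ∀ {k} {a b : Fin k} → a ≢ b → δ a b ≡ 0
δ-≢ {a = a} {b} a≢b with a ≟ b
... | yes a≡b = ⊥-elim (a≢b a≡b)
... | no _    = refl

sumFin-cong : ∀ k {f g : Fin k → ℕ} → (∀ i → f i ≡ g i) → sumFin k f ≡ sumFin k g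
sumFin-cong zero    _  = refl
sumFin-cong (suc k) eq = cong₂ _+_ (eq zero) (sumFin-cong k (λ i → eq (suc i)))

sumFin-zero : ∀ k → sumFin k (λ _ → 0) ≡ 0
sumFin-zero zero    = refl
sumFin-zero (suc k) = sumFin-zero k

sumFin-two : ∀ k → sumFin k (λ _ → 2) ≡ k + k
sumFin-two zero    = refl
sumFin-two (suc k) rewrite sumFin-two k | +-suc k k = refl

sumFin-+ : ∀ k (f g : Fin k → ℕ) → sumFin k (λ i → f i + g i) ≡ sumFin k f + sumFin k g
sumFin-+ zero    f g = refl
sumFin-+ (suc k) f g rewrite sumFin-+ k (λ i → f (suc i)) (λ i → g (suc i)) =
  interchange (f zero) (g zero) _ _

sumFin-δ* : ∀ k (a : Fin k) (g : Fin k → ℕ) → sumFin k (λ i → δ a i * g i) ≡ g a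
sumFin-δ* (suc k) zero    g rewrite sumFin-zero k = trans (+-identityʳ _) (+-identityʳ (g zero))
sumFin-δ* (suc k) (suc a) g = sumFin-δ* k a (λ i → g (suc i))

sumFin-δ : ∀ k (a : Fin k) → sumFin k (δ a) ≡ 1
sumFin-δ k a = trans (sumFin-cong k (λ i → sym (*-identityʳ (δ a i)))) (sumFin-δ* k a (λ _ → 1))

sumFin-even : ∀ k (f : Fin k → ℕ) → (∀ i → odd (f i) ≡ false) → odd (sumFin k f) ≡ false
sumFin-even zero    f _    = refl
sumFin-even (suc k) f even
  rewrite odd-+ (f zero) (sumFin k (λ i → f (suc i))) | even zero =
  sumFin-even k (λ i → f (suc i)) (λ i → even (suc i))

sumFin-≤ : ∀ k (f : Fin k → ℕ) → (∀ i → f i ≤ 1) → sumFin k f ≤ k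
sumFin-≤ zero    f _  = z≤n
sumFin-≤ (suc k) f ≤1 = +-mono-≤ (≤1 zero) (sumFin-≤ k (λ i → f (suc i)) (λ i → ≤1 (suc i)))

sumFin-< : ∀ k (f : Fin k → ℕ) (a : Fin k) → (∀ i → f i ≤ 1) → f a ≡ 0 → sumFin k f < k
sumFin-< (suc k) f zero    ≤1 fa≡0 rewrite fa≡0 = s≤s (sumFin-≤ k (λ i → f (suc i)) (λ i → ≤1 (suc i)))
sumFin-< (suc k) f (suc a) ≤1 fa≡0 =
  subst (_≤ suc k) (+-suc (f zero) _)
        (+-mono-≤ (≤1 zero) (sumFin-< k (λ i → f (suc i)) a (λ i → ≤1 (suc i)) fa≡0))

module Walks (G : Graph) where

  V = Fin (n G)
  E = Fin (m G)

  IsEnd : V → E → Set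
  IsEnd x e = proj₁ (ends G e) ≡ x ⊎ proj₂ (ends G e) ≡ x

  endsAt-pos⇒IsEnd : ∀ {x e} → 1 ≤ endsAt G e x → IsEnd x e
  endsAt-pos⇒IsEnd {x} {e} pos with proj₁ (ends G e) ≟ x | proj₂ (ends G e) ≟ x
  ... | yes p₁≡x | _        = inj₁ p₁≡x
  ... | no _     | yes p₂≡x = inj₂ p₂≡x

  Dart = E × Bool

  edge : Dart → E
  edge = proj₁

  source target : Dart → V
  source (e , true)  = proj₁ (ends G e)
  source (e , false) = proj₂ (ends G e)
  target (e , true)  = proj₂ (ends G e)
  target (e , false) = proj₁ (ends G e)

  EndOf : Dart → V → Set
  EndOf d x = x ≡ source d ⊎ x ≡ target d

  IsEnd⇒EndOf : ∀ {x} d → IsEnd x (edge d) → EndOf d x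
  IsEnd⇒EndOf (e , true)  (inj₁ refl) = inj₁ refl
  IsEnd⇒EndOf (e , true)  (inj₂ refl) = inj₂ refl
  IsEnd⇒EndOf (e , false) (inj₁ refl) = inj₂ refl
  IsEnd⇒EndOf (e , false) (inj₂ refl) = inj₁ refl

  dart-leaving : ∀ {x} e → IsEnd x e → Σ Dart λ d → edge d ≡ e × source d ≡ x
  dart-leaving e (inj₁ refl) = (e , true)  , refl , refl
  dart-leaving e (inj₂ refl) = (e , false) , refl , refl

  δ-source+δ-target : ∀ d v → δ (source d) v + δ (target d) v ≡ endsAt G (edge d) v
  δ-source+δ-target (e , true)  v = refl
  δ-source+δ-target (e , false) v = +-comm (δ (proj₂ (ends G e)) v) _

  data Walk : V → V → Set where
    []   : ∀ {u} → Walk u u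
    step : ∀ {u w} (d : Dart) → source d ≡ u → Walk (target d) w → Walk u w

  _++_ : ∀ {u x w} → Walk u x → Walk x w → Walk u w
  []          ++ Y = Y
  step d eq X ++ Y = step d eq (X ++ Y)

  length : ∀ {u w} → Walk u w → ℕ
  length []           = 0
  length (step _ _ X) = suc (length X)

  mult : ∀ {u w} → Walk u w → E → ℕ
  mult []           e = 0
  mult (step d _ X) e = δ (edge d) e + mult X e

  departures arrivals : ∀ {u w} → Walk u w → V → ℕ
  departures []           v = 0
  departures (step d _ X) v = δ (source d) v + departures X v
  arrivals   []           v = 0
  arrivals   (step d _ X) v = δ (target d) v + arrivals X v

  -- departures from v at steps 0, 2, 4, … (resp. 1, 3, 5, …)
  mutual
    evenDepartures : ∀ {u w} → Walk u w → V → ℕ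
    evenDepartures []           v = 0
    evenDepartures (step d _ X) v = δ (source d) v + oddDepartures X v

    oddDepartures : ∀ {u w} → Walk u w → V → ℕ
    oddDepartures []           v = 0
    oddDepartures (step _ _ X) v = evenDepartures X v

  length-++ : ∀ {u x w} (X : Walk u x) (Y : Walk x w) → length (X ++ Y) ≡ length X + length Y
  length-++ []           Y = refl
  length-++ (step d _ X) Y = cong suc (length-++ X Y)

  mult-++ : ∀ {u x w} (X : Walk u x) (Y : Walk x w) e → mult (X ++ Y) e ≡ mult X e + mult Y e
  mult-++ []           Y e = refl
  mult-++ (step d _ X) Y e = trans (cong (δ (edge d) e +_) (mult-++ X Y e)) (sym (+-assoc (δ (edge d) e) _ _))

  sumFin-mult : ∀ {u w} (X : Walk u w) → sumFin (m G) (mult X) ≡ length X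
  sumFin-mult []           = sumFin-zero (m G)
  sumFin-mult (step d _ X) =
    trans (sumFin-+ (m G) (δ (edge d)) (mult X)) (cong₂ _+_ (sumFin-δ (m G) (edge d)) (sumFin-mult X))

  sumFin-departures : ∀ {u w} (X : Walk u w) → sumFin (n G) (departures X) ≡ length X
  sumFin-departures []           = sumFin-zero (n G)
  sumFin-departures (step d _ X) =
    trans (sumFin-+ (n G) (δ (source d)) (departures X)) (cong₂ _+_ (sumFin-δ (n G) (source d)) (sumFin-departures X))

  mutual
    sumFin-evenDepartures : ∀ {u w} (X : Walk u w) → sumFin (n G) (evenDepartures X) ≡ ⌈ length X /2⌉
    sumFin-evenDepartures []           = sumFin-zero (n G)
    sumFin-evenDepartures (step d _ X) =
      trans (sumFin-+ (n G) (δ (source d)) (oddDepartures X))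
            (cong₂ _+_ (sumFin-δ (n G) (source d)) (sumFin-oddDepartures X))

    sumFin-oddDepartures : ∀ {u w} (X : Walk u w) → sumFin (n G) (oddDepartures X) ≡ ⌊ length X /2⌋
    sumFin-oddDepartures []           = sumFin-zero (n G)
    sumFin-oddDepartures (step _ _ X) = sumFin-evenDepartures X

  even+oddDepartures : ∀ {u w} (X : Walk u w) v → evenDepartures X v + oddDepartures X v ≡ departures X v
  even+oddDepartures []           v = refl
  even+oddDepartures (step d _ X) v = begin
    (δ (source d) v + oddDepartures X v) + evenDepartures X v ≡⟨ +-assoc (δ (source d) v) _ _ ⟩
    δ (source d) v + (oddDepartures X v + evenDepartures X v) ≡⟨ cong (δ (source d) v +_) (+-comm (oddDepartures X v) _) ⟩
    δ (source d) v + (evenDepartures X v + oddDepartures X v) ≡⟨ cong (δ (source d) v +_) (even+oddDepartures X v) ⟩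
    δ (source d) v + departures X v                           ∎
    where open ≡-Reasoning

  sumFin-mult*endsAt : ∀ {u w} (X : Walk u w) v →
    sumFin (m G) (λ e → mult X e * endsAt G e v) ≡ departures X v + arrivals X v
  sumFin-mult*endsAt []           v = sumFin-zero (m G)
  sumFin-mult*endsAt (step d _ X) v = begin
    sumFin (m G) (λ e → (δ (edge d) e + mult X e) * endsAt G e v)
      ≡⟨ sumFin-cong (m G) (λ e → *-distribʳ-+ (endsAt G e v) (δ (edge d) e) (mult X e)) ⟩
    sumFin (m G) (λ e → δ (edge d) e * endsAt G e v + mult X e * endsAt G e v)
      ≡⟨ sumFin-+ (m G) (λ e → δ (edge d) e * endsAt G e v) (λ e → mult X e * endsAt G e v) ⟩
    sumFin (m G) (λ e → δ (edge d) e * endsAt G e v) + sumFin (m G) (λ e → mult X e * endsAt G e v)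
      ≡⟨ cong₂ _+_ (sumFin-δ* (m G) (edge d) (λ e → endsAt G e v)) (sumFin-mult*endsAt X v) ⟩
    endsAt G (edge d) v + (departures X v + arrivals X v)
      ≡⟨ cong (_+ (departures X v + arrivals X v)) (sym (δ-source+δ-target d v)) ⟩
    (δ (source d) v + δ (target d) v) + (departures X v + arrivals X v)
      ≡⟨ interchange (δ (source d) v) (δ (target d) v) _ _ ⟩
    (δ (source d) v + departures X v) + (δ (target d) v + arrivals X v) ∎
    where open ≡-Reasoning

  arrivals-departures : ∀ {u w} (X : Walk u w) v → δ u v + arrivals X v ≡ departures X v + δ w v
  arrivals-departures {u} []                  v = +-comm (δ u v) 0
  arrivals-departures {w = w} (step d refl X) v = begin
    δ (source d) v + (δ (target d) v + arrivals X v) ≡⟨ cong (δ (source d) v +_) (arrivals-departures X v) ⟩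
    δ (source d) v + (departures X v + δ w v)        ≡⟨ +-assoc (δ (source d) v) _ _ ⟨
    (δ (source d) v + departures X v) + δ w v        ∎
    where open ≡-Reasoning

  closed-arrivals≡departures : ∀ {u} (X : Walk u u) v → arrivals X v ≡ departures X v
  closed-arrivals≡departures {u} X v =
    +-cancelʳ-≡ (δ u v) _ _ (trans (+-comm (arrivals X v) _) (arrivals-departures X v))

  _∈_ : ∀ {u w} → Dart → Walk u w → Set
  d ∈ []           = ⊥
  d ∈ step d′ _ X = d ≡ d′ ⊎ d ∈ X

  ∈⇒mult-pos : ∀ {u w} d (X : Walk u w) → d ∈ X → 1 ≤ mult X (edge d)
  ∈⇒mult-pos d (step .d _ X) (inj₁ refl) rewrite δ-refl (edge d) = s≤s z≤n
  ∈⇒mult-pos d (step d′ _ X) (inj₂ d∈X)   = ≤-trans (∈⇒mult-pos d X d∈X) (m≤n+m _ _)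

  mult-pos⇒∈ : ∀ {u w} (X : Walk u w) e → 1 ≤ mult X e → Σ Dart λ d → d ∈ X × edge d ≡ e
  mult-pos⇒∈ (step d _ X) e pos with edge d ≟ e
  ... | yes d↦e = d , inj₁ refl , d↦e
  ... | no _ with mult-pos⇒∈ X e pos
  ...   | d′ , d′∈X , d′↦e = d′ , inj₂ d′∈X , d′↦e

  OnWalk : ∀ {u w} → Walk u w → V → Set
  OnWalk {u} X x = x ≡ u ⊎ Σ Dart λ d → d ∈ X × EndOf d x

  SplitAt : ∀ {u w} → Walk u w → V → Set
  SplitAt {u} {w} X x = Σ (Walk u x) λ P → Σ (Walk x w) λ Q → X ≡ P ++ Q

  split-at-end : ∀ {u w} (X : Walk u w) d x → d ∈ X → EndOf d x → SplitAt X x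
  split-at-end (step d refl X) .d ._ (inj₁ refl) (inj₁ refl) = [] , step d refl X , refl
  split-at-end (step d refl X) .d ._ (inj₁ refl) (inj₂ refl) = step d refl [] , X , refl
  split-at-end (step d refl X) d′ x (inj₂ d′∈X) end with split-at-end X d′ x d′∈X end
  ... | P , Q , refl = step d refl P , Q , refl

  split-on : ∀ {u w} (X : Walk u w) {x} → OnWalk X x → SplitAt X x
  split-on X (inj₁ refl)            = [] , X , refl
  split-on X (inj₂ (d , d∈X , end)) = split-at-end X d _ d∈X end

  rotate : ∀ {u x} (X : Walk u u) → OnWalk X x →
    Σ (Walk x x) λ Y → (∀ e → mult Y e ≡ mult X e) × length Y ≡ length X
  rotate X on with split-on X on
  ... | P , Q , refl =
    Q ++ P ,
    (λ e → trans (mult-++ Q P e) (trans (+-comm (mult Q e) _) (sym (mult-++ P Q e)))) ,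
    trans (length-++ Q P) (trans (+-comm (length Q) _) (sym (length-++ P Q)))

  excise : ∀ {u v} (A : Walk u v) (B : Walk v v) (C : Walk v u) →
    (∀ e → mult (A ++ (B ++ C)) e ≡ mult B e + mult (C ++ A) e) ×
    length (A ++ (B ++ C)) ≡ length B + length (C ++ A)
  excise A B C =
    (λ e → begin
      mult (A ++ (B ++ C)) e            ≡⟨ mult-++ A (B ++ C) e ⟩
      mult A e + mult (B ++ C) e        ≡⟨ cong (mult A e +_) (mult-++ B C e) ⟩
      mult A e + (mult B e + mult C e)  ≡⟨ rotate-+ (mult A e) (mult B e) (mult C e) ⟩
      mult B e + (mult C e + mult A e)  ≡⟨ cong (mult B e +_) (mult-++ C A e) ⟨
      mult B e + mult (C ++ A) e        ∎) ,
    (begin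
      length (A ++ (B ++ C))                  ≡⟨ length-++ A (B ++ C) ⟩
      length A + length (B ++ C)              ≡⟨ cong (length A +_) (length-++ B C) ⟩
      length A + (length B + length C)        ≡⟨ rotate-+ (length A) (length B) (length C) ⟩
      length B + (length C + length A)        ≡⟨ cong (length B +_) (length-++ C A) ⟨
      length B + length (C ++ A)              ∎)
    where
      open ≡-Reasoning
      rotate-+ : ∀ a b c → a + (b + c) ≡ b + (c + a)
      rotate-+ a b c = trans (+-comm a (b + c)) (+-assoc b c a)

  mutual
    split-even : ∀ {u w} (X : Walk u w) v → 1 ≤ evenDepartures X v →
      Σ (Walk u v) λ P → Σ (Walk v w) λ Q → X ≡ P ++ Q × odd (length P) ≡ false
    split-even (step d refl X) v pos with source d ≟ v
    ... | yes refl = [] , step d refl X , refl , refl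
    ... | no _ with split-odd X v pos
    ...   | P , Q , refl , odd-P = step d refl P , Q , refl , cong not odd-P

    split-odd : ∀ {u w} (X : Walk u w) v → 1 ≤ oddDepartures X v →
      Σ (Walk u v) λ P → Σ (Walk v w) λ Q → X ≡ P ++ Q × odd (length P) ≡ true
    split-odd (step d refl X) v pos with split-even X v pos
    ... | P , Q , refl , even-P = step d refl P , Q , refl , cong not even-P

  split-odd-cycle : ∀ {u w} (X : Walk u w) v → 1 ≤ evenDepartures X v → 1 ≤ oddDepartures X v →
    Σ (Walk u v) λ A → Σ (Walk v v) λ B → Σ (Walk v w) λ C →
      X ≡ A ++ (B ++ C) × odd (length B) ≡ true
  split-odd-cycle (step d refl X) v even-pos odd-pos with source d ≟ v
  ... | yes refl with split-even X (source d) odd-pos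
  ...   | P , Q , refl , even-P = [] , step d refl P , Q , refl , cong not even-P
  split-odd-cycle (step d refl X) v even-pos odd-pos | no _ with split-odd-cycle X v odd-pos even-pos
  ...   | A , B , C , refl , odd-B = step d refl A , B , C , refl , odd-B

  Reach-trans : ∀ {S a b c} → Reach G S a b → Reach G S b c → Reach G S a c
  Reach-trans p here        = p
  Reach-trans p (fwd e s q) = fwd e s (Reach-trans p q)
  Reach-trans p (bwd e s q) = bwd e s (Reach-trans p q)

  Reach-sym : ∀ {S a b} → Reach G S a b → Reach G S b a
  Reach-sym here        = here
  Reach-sym (fwd e s q) = Reach-trans (bwd e s here) (Reach-sym q)
  Reach-sym (bwd e s q) = Reach-trans (fwd e s here) (Reach-sym q)

  dart-reach : ∀ S d → S (edge d) ≡ true → Reach G S (source d) (target d)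
  dart-reach S (e , true)  s = fwd e s here
  dart-reach S (e , false) s = bwd e s here

  reach-along : ∀ S {u w} (X : Walk u w) → (∀ d → d ∈ X → S (edge d) ≡ true) →
    ∀ d {x} → d ∈ X → EndOf d x → Reach G S u x
  reach-along S (step d refl X) inS .d (inj₁ refl) (inj₁ refl) = here
  reach-along S (step d refl X) inS .d (inj₁ refl) (inj₂ refl) = dart-reach S d (inS d (inj₁ refl))
  reach-along S (step d refl X) inS d′ (inj₂ d′∈X) end =
    Reach-trans (dart-reach S d (inS d (inj₁ refl)))
                (reach-along S X (λ d″ d″∈X → inS d″ (inj₂ d″∈X)) d′ d′∈X end)

  Covers : ∀ {u w} → Walk u w → EdgeSet G → Set
  Covers X S = ∀ e → mult X e ≡ indicator (S e)

  ∈⇒covered : ∀ {u w S} (X : Walk u w) → Covers X S → ∀ d → d ∈ X → S (edge d) ≡ true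
  ∈⇒covered X cov d d∈X = indicator-pos (subst (1 ≤_) (cov (edge d)) (∈⇒mult-pos d X d∈X))
    where
      indicator-pos : ∀ {b} → 1 ≤ indicator b → b ≡ true
      indicator-pos {true} _ = refl

  covered⇒∈ : ∀ {u w S} (X : Walk u w) → Covers X S → ∀ e → S e ≡ true →
    Σ Dart λ d → d ∈ X × edge d ≡ e
  covered⇒∈ X cov e Se = mult-pos⇒∈ X e (subst (1 ≤_) (sym (trans (cov e) (cong indicator Se))) (s≤s z≤n))

  source-IsEnd : ∀ d → IsEnd (source d) (edge d)
  source-IsEnd (e , true)  = inj₁ refl
  source-IsEnd (e , false) = inj₂ refl

  degIn-covered : ∀ {u w S} (X : Walk u w) → Covers X S → ∀ x → degIn G S x ≡ departures X x + arrivals X x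
  degIn-covered {S = S} X cov x = trans (sumFin-cong (m G) term) (sumFin-mult*endsAt X x)
    where
      term : ∀ e → (if S e then endsAt G e x else 0) ≡ mult X e * endsAt G e x
      term e = trans (if-then-0≡indicator* (S e) (endsAt G e x)) (cong (_* endsAt G e x) (sym (cov e)))

  size-covered : ∀ {u w S} (X : Walk u w) → Covers X S → size G S ≡ length X
  size-covered X cov = trans (sumFin-cong (m G) (λ e → sym (cov e))) (sumFin-mult X)

  closed-cover⇒eulerian : ∀ {v S} (X : Walk v v) → Covers X S → Eulerian G S
  closed-cover⇒eulerian {v} {S} X cov = connected , even-degrees
    where
      reach-incident : ∀ x → Incident G S x → Reach G S v x
      reach-incident x (e , Se , x-end) with covered⇒∈ X cov e Se
      ... | d , d∈X , refl = reach-along S X (∈⇒covered X cov) d d∈X (IsEnd⇒EndOf d x-end)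

      connected : ∀ x y → Incident G S x → Incident G S y → Reach G S x y
      connected x y ix iy = Reach-trans (Reach-sym (reach-incident x ix)) (reach-incident y iy)

      even-degrees : ∀ x → degIn G S x % 2 ≡ 0
      even-degrees x = odd⇒%2 (degIn G S x) (begin
        odd (degIn G S x)                       ≡⟨ cong odd (degIn-covered X cov x) ⟩
        odd (departures X x + arrivals X x)
          ≡⟨ cong (λ a → odd (departures X x + a)) (closed-arrivals≡departures X x) ⟩
        odd (departures X x + departures X x)   ≡⟨ odd-double (departures X x) ⟩
        false                                   ∎)
        where open ≡-Reasoning

  odd-closed-cover⇒rooted : ∀ {v S} (X : Walk v v) → Covers X S → odd (length X) ≡ true →
    OddEulerian G S × Incident G S v
  odd-closed-cover⇒rooted {S = S} X@(step d refl _) cov odd-X =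
    (closed-cover⇒eulerian X cov , odd⇒%2 (size G S) (trans (cong odd (size-covered X cov)) odd-X)) ,
    (edge d , ∈⇒covered X cov d (inj₁ refl) , source-IsEnd d)

  -- The complement of B in T is traversed by the closed walk C ++ A through v.
  odd-cycle⇒rooted2OddDecomposition : ∀ {r v} (T : Walk r r) (A : Walk r v) (B : Walk v v) (C : Walk v r) →
    T ≡ A ++ (B ++ C) → Covers T (allEdges G) → odd (length T) ≡ false → odd (length B) ≡ true →
    Rooted2OddDecomposition G
  odd-cycle⇒rooted2OddDecomposition {v = v} T A B C refl cover even-T odd-B =
    inB , proj₁ odd-cover-B , proj₁ odd-cover-CA , v , proj₂ odd-cover-B , proj₂ odd-cover-CA
    where
      inB : EdgeSet G
      inB e = mult B e ≡ᵇ 1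

      mults : ∀ e → mult B e ≡ indicator (inB e) × mult (C ++ A) e ≡ indicator (not (inB e))
      mults e = +≡1⇒indicators (mult B e) (mult (C ++ A) e) (trans (sym (proj₁ (excise A B C) e)) (cover e))

      odd-CA : odd (length (C ++ A)) ≡ true
      odd-CA = odd-summand (length B) _ (trans (cong odd (sym (proj₂ (excise A B C)))) even-T) odd-B

      odd-cover-B : OddEulerian G inB × Incident G inB v
      odd-cover-B = odd-closed-cover⇒rooted B (λ e → proj₁ (mults e)) odd-B
      odd-cover-CA : OddEulerian G (λ e → not (inB e)) × Incident G (λ e → not (inB e)) v
      odd-cover-CA = odd-closed-cover⇒rooted (C ++ A) (λ e → proj₂ (mults e)) odd-CA

module EulerTour (G : Graph) (connected : Connected G) (even : ∀ v → deg G v % 2 ≡ 0) where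
  open Walks G

  IsTrail : ∀ {u w} → Walk u w → Set
  IsTrail X = ∀ e → mult X e ≤ 1

  Tour : Set
  Tour = Σ V λ r → Σ (Walk r r) λ T → Covers T (allEdges G)

  LongerTrail : ∀ {u w} → Walk u w → Set
  LongerTrail X = Σ V λ u′ → Σ V λ w′ → Σ (Walk u′ w′) λ Y → IsTrail Y × length Y ≡ suc (length X)

  -- At the end of an open walk there is one more arrival than departure.
  stuck-open-trail-odd-degree : ∀ {u w} (X : Walk u w) → IsTrail X → u ≢ w →
    (∀ f → mult X f ≡ 0 → endsAt G f w ≡ 0) → odd (deg G w) ≡ true
  stuck-open-trail-odd-degree {u} {w} X trail u≢w stuck = begin
    odd (deg G w)                                       ≡⟨ cong odd (sumFin-cong (m G) mult*endsAt≡endsAt) ⟩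
    odd (sumFin (m G) (λ f → mult X f * endsAt G f w))  ≡⟨ cong odd (sumFin-mult*endsAt X w) ⟩
    odd (departures X w + arrivals X w)                 ≡⟨ cong (λ a → odd (departures X w + a)) arrivals≡ ⟩
    odd (departures X w + suc (departures X w))         ≡⟨ odd-+ (departures X w) _ ⟩
    odd (departures X w) xor not (odd (departures X w)) ≡⟨ xor-inverseʳ (odd (departures X w)) ⟩
    true                                                ∎
    where
      open ≡-Reasoning

      mult*endsAt≡endsAt : ∀ f → endsAt G f w ≡ mult X f * endsAt G f w
      mult*endsAt≡endsAt f with mult X f | trail f | stuck f
      ... | zero     | _ | stuck-f = stuck-f refl
      ... | suc zero | _ | _       = sym (+-identityʳ _)
      ... | suc (suc _) | s≤s () | _

      arrivals≡ : arrivals X w ≡ suc (departures X w)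
      arrivals≡ = trans (subst₂ (λ a b → a + arrivals X w ≡ departures X w + b) (δ-≢ u≢w) (δ-refl w)
                                (arrivals-departures X w))
                        (+-comm (departures X w) 1)

  stuck-trail-closed : ∀ {u w} (X : Walk u w) → IsTrail X →
    (∀ f → mult X f ≡ 0 → endsAt G f w ≡ 0) → u ≡ w
  stuck-trail-closed {u} {w} X trail stuck with u ≟ w
  ... | yes u≡w = u≡w
  ... | no u≢w
    with () ← trans (sym (stuck-open-trail-odd-degree X trail u≢w stuck)) (%2⇒odd (deg G w) false (even w))

  unused-edge-at-end : ∀ {u w} (X : Walk u w) → IsTrail X → u ≢ w → Σ E λ f → mult X f ≡ 0 × IsEnd w f
  unused-edge-at-end {w = w} X trail u≢w with any? (λ f → (mult X f ≟ℕ 0) ×-dec (1 ≤? endsAt G f w))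
  ... | yes (f , unused , pos) = f , unused , endsAt-pos⇒IsEnd pos
  ... | no none = ⊥-elim (u≢w (stuck-trail-closed X trail
                    (λ f unused → n≤0⇒n≡0 (≤-pred (≰⇒> (λ pos → none (f , unused , pos)))))))

  Frontier : ∀ {u w} → Walk u w → Set
  Frontier X = Σ E λ f → mult X f ≡ 0 × Σ V λ x → OnWalk X x × IsEnd x f

  cross-edge : ∀ {u w} (X : Walk u w) e {x y} → IsEnd x e → IsEnd y e → OnWalk X x → OnWalk X y ⊎ Frontier X
  cross-edge X e x-end y-end x-on with mult X e ≟ℕ 0
  ... | yes unused = inj₂ (e , unused , _ , x-on , x-end)
  ... | no used with mult-pos⇒∈ X e (n≢0⇒n>0 used)
  ...   | d , d∈X , refl = inj₁ (inj₂ (d , d∈X , IsEnd⇒EndOf d y-end))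

  reach⇒onWalk⊎frontier : ∀ {u w y} (X : Walk u w) → Reach G (allEdges G) u y → OnWalk X y ⊎ Frontier X
  reach⇒onWalk⊎frontier X here = inj₁ (inj₁ refl)
  reach⇒onWalk⊎frontier X (fwd e _ q) with reach⇒onWalk⊎frontier X q
  ... | inj₁ on = cross-edge X e (inj₁ refl) (inj₂ refl) on
  ... | inj₂ fr = inj₂ fr
  reach⇒onWalk⊎frontier X (bwd e _ q) with reach⇒onWalk⊎frontier X q
  ... | inj₁ on = cross-edge X e (inj₂ refl) (inj₁ refl) on
  ... | inj₂ fr = inj₂ fr

  unused-edge⇒frontier : ∀ {u w} (X : Walk u w) e → mult X e ≡ 0 → Frontier X
  unused-edge⇒frontier {u} X e unused with reach⇒onWalk⊎frontier X (connected u (proj₁ (ends G e)))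
  ... | inj₁ on = e , unused , _ , on , inj₁ refl
  ... | inj₂ fr = fr

  extend : ∀ {u x} (X : Walk u x) → IsTrail X → ∀ f → mult X f ≡ 0 → IsEnd x f → LongerTrail X
  extend X trail f unused x-end with dart-leaving f x-end
  ... | d , refl , leaves =
    _ , _ , X ++ step d leaves [] , trail′ ,
    trans (length-++ X (step d leaves [])) (+-comm (length X) 1)
    where
      trail′ : IsTrail (X ++ step d leaves [])
      trail′ e rewrite mult-++ X (step d leaves []) e with edge d ≟ e
      ... | yes refl rewrite unused = s≤s z≤n
      ... | no _     rewrite +-identityʳ (mult X e) = trail e

  longer-trail : ∀ {u w} (X : Walk u w) → IsTrail X → ∀ e → mult X e ≡ 0 → LongerTrail X
  longer-trail {u} {w} X trail e unused with u ≟ w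
  ... | no u≢w with unused-edge-at-end X trail u≢w
  ...   | f , f-unused , w-end = extend X trail f f-unused w-end
  longer-trail X trail e unused | yes refl with unused-edge⇒frontier X e unused
  ...   | f , f-unused , x , x-on , x-end with rotate X x-on
  ...     | Y , mult-Y , length-Y with extend Y (λ e → subst (_≤ 1) (sym (mult-Y e)) (trail e)) f
                                           (trans (mult-Y f) f-unused) x-end
  ...       | u′ , w′ , Z , trail-Z , length-Z = u′ , w′ , Z , trail-Z , trans length-Z (cong suc length-Y)

  complete-trail⇒tour : ∀ {u w} (X : Walk u w) → IsTrail X → (∀ e → mult X e ≢ 0) → Tour
  complete-trail⇒tour {u} X trail used
    with refl ← stuck-trail-closed X trail (λ f unused → ⊥-elim (used f unused)) =
    u , X , λ e → once (mult X e) (trail e) (used e)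
    where
      once : ∀ c → c ≤ 1 → c ≢ 0 → c ≡ 1
      once zero       _ c≢0 = ⊥-elim (c≢0 refl)
      once (suc zero) _ _   = refl
      once (suc (suc _)) (s≤s ()) _

  incomplete-trail-short : ∀ {u w} (X : Walk u w) → IsTrail X → ∀ e → mult X e ≡ 0 → length X < m G
  incomplete-trail-short X trail e unused = subst (_< m G) (sumFin-mult X) (sumFin-< (m G) (mult X) e trail unused)

  tour-from : (k : ℕ) → ∀ {u w} (X : Walk u w) → IsTrail X → m G ≤ length X + k → Tour
  tour-from k X trail bound with any? (λ e → mult X e ≟ℕ 0)
  ... | no none = complete-trail⇒tour X trail (λ e unused → none (e , unused))
  tour-from zero X trail bound | yes (e , unused) =
    ⊥-elim (<⇒≱ (incomplete-trail-short X trail e unused) (subst (m G ≤_) (+-identityʳ _) bound))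
  tour-from (suc k) X trail bound | yes (e , unused) with longer-trail X trail e unused
  ... | _ , _ , Y , trail-Y , length-Y =
    tour-from k Y trail-Y (subst (m G ≤_) (trans (+-suc _ k) (cong (_+ k) (sym length-Y))) bound)

  euler-tour : V → Tour
  euler-tour v = tour-from (m G) ([] {v}) (λ _ → z≤n) ≤-refl

module QuarticTour (G : Graph) (quartic : Regular 4 G)
                   {r : Fin (n G)} (T : Walks.Walk G r r) (cover : Walks.Covers G T (allEdges G)) where
  open Walks G

  departures≡2 : ∀ v → departures T v ≡ 2
  departures≡2 v = m+m≡n+n⇒m≡n (departures T v) 2 (begin
    departures T v + departures T v ≡⟨ cong (departures T v +_) (closed-arrivals≡departures T v) ⟨
    departures T v + arrivals T v   ≡⟨ degIn-covered T cover v ⟨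
    deg G v                         ≡⟨ quartic v ⟩
    4                               ∎)
    where open ≡-Reasoning

  length≡n+n : length T ≡ n G + n G
  length≡n+n = trans (sym (sumFin-departures T)) (trans (sumFin-cong (n G) departures≡2) (sumFin-two (n G)))

  even-length : odd (length T) ≡ false
  even-length = trans (cong odd length≡n+n) (odd-double (n G))

  sumFin-evenDepartures≡n : sumFin (n G) (evenDepartures T) ≡ n G
  sumFin-evenDepartures≡n = trans (sumFin-evenDepartures T) (trans (cong ⌈_/2⌉ length≡n+n) (⌈n+n/2⌉≡n (n G)))

  even+oddDepartures≡2 : ∀ v → evenDepartures T v + oddDepartures T v ≡ 2
  even+oddDepartures≡2 v = trans (even+oddDepartures T v) (departures≡2 v)

  -- Each of the n G counts evenDepartures T v is 0, 1 or 2, and they sum to n G.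
  no-mixed-parity-vertex⇒even-order : (∀ v → evenDepartures T v ≢ 1) → odd (n G) ≡ false
  no-mixed-parity-vertex⇒even-order none = begin
    odd (n G)                             ≡⟨ cong odd sumFin-evenDepartures≡n ⟨
    odd (sumFin (n G) (evenDepartures T)) ≡⟨ sumFin-even (n G) (evenDepartures T) even-terms ⟩
    false                                 ∎
    where
      open ≡-Reasoning
      even-terms : ∀ v → odd (evenDepartures T v) ≡ false
      even-terms v = ≢1∧+≡2⇒even _ _ (even+oddDepartures≡2 v) (none v)

  mixed-parity-vertex : odd (n G) ≡ true → Σ V λ v → 1 ≤ evenDepartures T v × 1 ≤ oddDepartures T v
  mixed-parity-vertex odd-n with any? (λ v → evenDepartures T v ≟ℕ 1)
  ... | yes (v , even≡1) = v , ≤-reflexive (sym even≡1) , ≤-reflexive (sym odd≡1)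
    where
      odd≡1 : oddDepartures T v ≡ 1
      odd≡1 = +-cancelˡ-≡ 1 _ _ (trans (cong (_+ oddDepartures T v) (sym even≡1)) (even+oddDepartures≡2 v))
  ... | no none
    with () ← trans (sym odd-n) (no-mixed-parity-vertex⇒even-order (λ v even≡1 → none (v , even≡1)))

odd⇒Fin : ∀ k → odd k ≡ true → Fin k
odd⇒Fin (suc k) _ = zero

theorem1 : (G : Graph) → Connected G → Regular 4 G → n G % 2 ≡ 1 →
    Rooted2OddDecomposition G
theorem1 G connected quartic n%2≡1 =
  let odd-n                       = %2⇒odd (n G) true n%2≡1
      (r , T , cover)             = euler-tour (odd⇒Fin (n G) odd-n)
      open QuarticTour G quartic T cover
      (v , even-pos , odd-pos)    = mixed-parity-vertex odd-n
      (A , B , C , T≡ABC , odd-B) = split-odd-cycle T v even-pos odd-pos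
  in odd-cycle⇒rooted2OddDecomposition T A B C T≡ABC cover even-length odd-B
  where
    open Walks G
    open EulerTour G connected (λ v → cong (_% 2) (quartic v))
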